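{- Let $n$ be a positive integer and $m=\lceil n/2\rceil$. Consider $n$ colored cubes arranged in several vertical stacks, such that each stack contains fewer than $m$ cubes and, for each color, fewer than $m$ cubes have this color. Then by performing at most $\lfloor m/2\rfloor-1$ moves, each move removing the top cube of some stack, one can reach a configuration satisfying (A) or (B), where (A): there exist two monochromatic stacks of different colors; (B): there exist two top cubes of different colors, there are at least $3$ (non-empty) stacks, and at least $2$ stacks are non-monochromatic.
   Context: Stacks are considered only when non-empty; the top cube of a stack is its highest cube. A stack is monochromatic if all of its cubes have the same color. "There exist two top cubes of different colors" means there are two non-empty stacks whose top cubes have different colors. -}

module Defs where

open import Data.Nat using (ℕ; zero; suc; _+_; _≤_; _<_; _≥_; _≟_; ⌈_/2⌉; ⌊_/2⌋; _∸_)
open import Data.Bool using (Bool; true; false)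
open import Data.Nat.ListAction using (sum)
open import Data.List using (List; []; _∷_; _++_; length; map; filter; concat)
open import Data.List.Membership.Propositional using (_∈_)
open import Data.List.Relation.Unary.All using (All; all?)
open import Data.Product using (Σ; ∃; ∃-syntax; _×_; _,_)
open import Data.Empty using (⊥)
open import Data.Unit using (⊤)
open import Relation.Binary.PropositionalEquality using (_≡_; _≢_)
open import Relation.Nullary using (¬_; Dec; yes; no)
open import Relation.Nullary.Decidable using (¬?)

Color : Set
Color = ℕ

-- A stack is a list of cubes (their colors), listed from TOP to BOTTOM:
-- the head of the list is the top cube.
Stack : Set
Stack = List Color

-- A configuration is a list of stacks.  Empty stacks may occur in the
-- list but are ignored: "stack" in the statement means non-empty stack.
Config : Set
Config = List Stack

totalCubes : Config → ℕ
totalCubes cfg = sum (map length cfg)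

colorCount : Color → Config → ℕ
colorCount c cfg = length (filter (λ x → x ≟ c) (concat cfg))

NonEmpty : Stack → Set
NonEmpty [] = ⊥
NonEmpty (_ ∷ _) = ⊤

nonEmpty? : (s : Stack) → Dec (NonEmpty s)
nonEmpty? [] = no (λ ())
nonEmpty? (_ ∷ _) = yes _

TopIs : Color → Stack → Set
TopIs c [] = ⊥
TopIs c (x ∷ _) = x ≡ c

MonoOf : Color → Stack → Set
MonoOf c s = NonEmpty s × All (_≡ c) s

Monochromatic : Stack → Set
Monochromatic [] = ⊤
Monochromatic (x ∷ s) = All (_≡ x) s

monochromatic? : (s : Stack) → Dec (Monochromatic s)
monochromatic? [] = yes _
monochromatic? (x ∷ s) = all? (λ y → y ≟ x) s

numStacks : Config → ℕ
numStacks cfg = length (filter nonEmpty? cfg)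

-- number of non-monochromatic stacks (such stacks are automatically non-empty)
numNonMono : Config → ℕ
numNonMono cfg = length (filter (λ s → ¬? (monochromatic? s)) cfg)

data Move : Config → Config → Set where
  move : (pre post : Config) (c : Color) (s : Stack) →
         Move (pre ++ (c ∷ s) ∷ post) (pre ++ s ∷ post)

data ReachIn : ℕ → Config → Config → Set where
  done : ∀ {cfg} → ReachIn zero cfg cfg
  step : ∀ {k cfg cfg' cfg''} → Move cfg cfg' → ReachIn k cfg' cfg'' →
         ReachIn (suc k) cfg cfg''

CondA : Config → Set
CondA cfg = ∃[ s ] ∃[ t ] ∃[ c ] ∃[ d ]
  (s ∈ cfg × t ∈ cfg × MonoOf c s × MonoOf d t × c ≢ d)

CondB : Config → Set
CondB cfg =
  (∃[ s ] ∃[ t ] ∃[ c ] ∃[ d ]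
    (s ∈ cfg × t ∈ cfg × TopIs c s × TopIs d t × c ≢ d))
  × numStacks cfg ≥ 3
  × numNonMono cfg ≥ 2

-- Write p = m − 1 and b = ⌊m/2⌋ − 1, so every stack and every colour class has at most
-- p cubes while n > 2p.  Counting cubes stack by stack shows that there are at least three
-- stacks and that, unless (A) already holds (and hence all monochromatic stacks share one
-- colour), at least two stacks are non-monochromatic.  If two tops differ, (B) holds.
-- Otherwise all tops have one colour c, and some stack carries a cube of another colour
-- below at most b cubes of colour c: if not, colour c would have at least
-- numStacks + b · numNonMono ≥ 3 + 2b > p cubes.  Removing those cubes exposes a new top
-- colour; the exposed stack is then either non-monochromatic, giving (B), or monochromatic,
-- giving (A) with any other monochromatic stack and (B) if there is none.

module Submission where

open import Defs
open import Data.Nat using (ℕ; _<_; _≤_; _∸_; ⌈_/2⌉; ⌊_/2⌋)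
open import Data.List.Membership.Propositional using (_∈_)
open import Data.List using (length)
open import Data.Product using (∃-syntax; _×_)
open import Data.Sum using (_⊎_)
open import Relation.Binary.PropositionalEquality using (_≡_)

open import Data.Nat using (zero; suc; _+_; _*_; z≤n; s≤s; s≤s⁻¹; _≟_; _≤?_)
open import Data.Nat.Properties
open import Data.List using (List; []; _∷_; _++_; filter; replicate)
open import Data.List.Properties using (filter-++; filter-all; length-++; length-replicate)
open import Data.List.Membership.Propositional using (find)
open import Data.List.Relation.Unary.All as All using (All; []; _∷_; all?)
open import Data.List.Relation.Unary.All.Properties using (¬All⇒Any¬; ++⁻ʳ; replicate⁺)
open import Data.List.Relation.Unary.Any using (here; there)
open import Data.List.Relation.Binary.Permutation.Propositional using (_↭_; ↭-sym)
open import Data.List.Relation.Binary.Permutation.Propositional.Properties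
  using (shift; filter-↭; ↭-length; ∈-resp-↭; All-resp-↭)
open import Data.Product using (_,_)
open import Data.Sum using (inj₁; inj₂)
import Data.Sum as Sum
open import Data.Empty using (⊥-elim)
open import Data.Unit using (⊤; tt)
open import Relation.Nullary using (¬_; ¬?; yes; no)
open import Relation.Unary using (Decidable)
open import Relation.Binary.PropositionalEquality using (_≢_; refl; sym; trans; cong; subst)
open import Algebra.Properties.CommutativeSemigroup +-commutativeSemigroup using (x∙yz≈y∙xz)

private
  variable
    A : Set

length-filter-++ : {P : A → Set} (P? : Decidable P) (xs ys : List A) →
  length (filter P? (xs ++ ys)) ≡ length (filter P? xs) + length (filter P? ys)
length-filter-++ P? xs ys = trans (cong length (filter-++ P? xs ys)) (length-++ (filter P? xs))

length-filter-↭ : {P : A → Set} (P? : Decidable P) {xs ys : List A} → xs ↭ ys →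
  length (filter P? xs) ≡ length (filter P? ys)
length-filter-↭ P? p = ↭-length (filter-↭ P? p)

count : Color → Stack → ℕ
count c s = length (filter (_≟ c) s)

colorCount-∷ : ∀ c s cfg → colorCount c (s ∷ cfg) ≡ count c s + colorCount c cfg
colorCount-∷ c s _ = length-filter-++ (_≟ c) s _

count-all : ∀ {c s} → All (_≡ c) s → count c s ≡ length s
count-all {c} a = cong length (filter-all (_≟ c) a)

count-replicate-++ : ∀ r c s → r ≤ count c (replicate r c ++ s)
count-replicate-++ r c s = begin
  r                                         ≡⟨ sym (length-replicate r) ⟩
  length (replicate r c)                    ≡⟨ sym (count-all (replicate⁺ r refl)) ⟩
  count c (replicate r c)                   ≤⟨ m≤m+n _ _ ⟩
  count c (replicate r c) + count c s       ≡⟨ sym (length-filter-++ (_≟ c) (replicate r c) s) ⟩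
  count c (replicate r c ++ s)              ∎
  where open ≤-Reasoning

numNonMono-mono : ∀ {x xs} cfg → All (_≡ x) xs → numNonMono ((x ∷ xs) ∷ cfg) ≡ numNonMono cfg
numNonMono-mono {x} {xs} _ mono with all? (_≟ x) xs
... | yes _ = refl
... | no ¬mono = ⊥-elim (¬mono mono)

numNonMono-nonMono : ∀ {x xs} cfg → ¬ All (_≡ x) xs → numNonMono ((x ∷ xs) ∷ cfg) ≡ suc (numNonMono cfg)
numNonMono-nonMono {x} {xs} _ ¬mono with all? (_≟ x) xs
... | yes mono = ⊥-elim (¬mono mono)
... | no _ = refl

numNonMono-∷-≤ : ∀ s cfg → numNonMono (s ∷ cfg) ≤ suc (numNonMono cfg)
numNonMono-∷-≤ [] _ = n≤1+n _
numNonMono-∷-≤ (x ∷ xs) _ with all? (_≟ x) xs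
... | yes _ = n≤1+n _
... | no _ = ≤-refl

totalCubes≤numStacks*p : ∀ {p} cfg → All (λ s → length s ≤ p) cfg → totalCubes cfg ≤ numStacks cfg * p
totalCubes≤numStacks*p [] [] = z≤n
totalCubes≤numStacks*p ([] ∷ cfg) (_ ∷ short) = totalCubes≤numStacks*p cfg short
totalCubes≤numStacks*p ((_ ∷ _) ∷ cfg) (h ∷ short) = +-mono-≤ h (totalCubes≤numStacks*p cfg short)

Mono⇒Of : Color → Stack → Set
Mono⇒Of c [] = ⊤
Mono⇒Of c (x ∷ xs) = All (_≡ x) xs → x ≡ c

mono⇒Of? : ∀ c → Decidable (Mono⇒Of c)
mono⇒Of? c [] = yes tt
mono⇒Of? c (x ∷ xs) with all? (_≟ x) xs | x ≟ c
... | _ | yes x≡c = yes (λ _ → x≡c)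
... | no ¬mono | no _ = yes (λ mono → ⊥-elim (¬mono mono))
... | yes mono | no x≢c = no (λ f → x≢c (f mono))

totalCubes≤numNonMono*p+colorCount : ∀ {p c} cfg → All (λ s → length s ≤ p) cfg → All (Mono⇒Of c) cfg →
  totalCubes cfg ≤ numNonMono cfg * p + colorCount c cfg
totalCubes≤numNonMono*p+colorCount [] [] [] = z≤n
totalCubes≤numNonMono*p+colorCount ([] ∷ cfg) (_ ∷ short) (_ ∷ monoOfC) =
  totalCubes≤numNonMono*p+colorCount cfg short monoOfC
totalCubes≤numNonMono*p+colorCount {p} {c} ((x ∷ xs) ∷ cfg) (h ∷ short) (f ∷ monoOfC)
  rewrite colorCount-∷ c (x ∷ xs) cfg with all? (_≟ x) xs
... | yes mono with refl ← f mono = begin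
  length (x ∷ xs) + totalCubes cfg               ≤⟨ +-monoʳ-≤ _ ih ⟩
  length (x ∷ xs) + (numNonMono cfg * p + colorCount c cfg)
                                                 ≡⟨ x∙yz≈y∙xz (length (x ∷ xs)) _ _ ⟩
  numNonMono cfg * p + (length (x ∷ xs) + colorCount c cfg)
                                                 ≡⟨ cong (λ k → numNonMono cfg * p + (k + colorCount c cfg))
                                                         (sym (count-all (refl ∷ mono))) ⟩
  numNonMono cfg * p + (count c (x ∷ xs) + colorCount c cfg) ∎
  where
  open ≤-Reasoning
  ih : totalCubes cfg ≤ numNonMono cfg * p + colorCount c cfg
  ih = totalCubes≤numNonMono*p+colorCount cfg short monoOfC
... | no _ = begin
  length (x ∷ xs) + totalCubes cfg               ≤⟨ +-mono-≤ h ih ⟩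
  p + (numNonMono cfg * p + colorCount c cfg)    ≡⟨ sym (+-assoc p _ _) ⟩
  suc (numNonMono cfg) * p + colorCount c cfg    ≤⟨ +-monoʳ-≤ (suc (numNonMono cfg) * p) (m≤n+m _ (count c (x ∷ xs))) ⟩
  suc (numNonMono cfg) * p + (count c (x ∷ xs) + colorCount c cfg) ∎
  where
  open ≤-Reasoning
  ih : totalCubes cfg ≤ numNonMono cfg * p + colorCount c cfg
  ih = totalCubes≤numNonMono*p+colorCount cfg short monoOfC

monoStackOfOtherColour : ∀ c cfg → ¬ All (Mono⇒Of c) cfg → ∃[ s ] ∃[ x ] (s ∈ cfg × MonoOf x s × x ≢ c)
monoStackOfOtherColour c cfg ¬all with find (¬All⇒Any¬ (mono⇒Of? c) cfg ¬all)
... | [] , _ , ¬f = ⊥-elim (¬f tt)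
... | x ∷ xs , s∈ , ¬f with all? (_≟ x) xs
...   | yes mono = (x ∷ xs) , x , s∈ , (tt , refl ∷ mono) , λ x≡c → ¬f (λ _ → x≡c)
...   | no ¬mono = ⊥-elim (¬f λ mono → ⊥-elim (¬mono mono))

-- Colour 0 is only a first guess; a monochromatic stack of another colour replaces it.
condA⊎monoStacksOfOneColour : ∀ cfg → CondA cfg ⊎ ∃[ c ] All (Mono⇒Of c) cfg
condA⊎monoStacksOfOneColour cfg with all? (mono⇒Of? 0) cfg
... | yes all0 = inj₂ (0 , all0)
... | no ¬all0 with monoStackOfOtherColour 0 cfg ¬all0
...   | s , x , s∈ , monoS , _ with all? (mono⇒Of? x) cfg
...     | yes allx = inj₂ (x , allx)
...     | no ¬allx with monoStackOfOtherColour x cfg ¬allx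
...       | t , y , t∈ , monoT , y≢x = inj₁ (s , t , x , y , s∈ , t∈ , monoS , monoT , λ x≡y → y≢x (sym x≡y))

module _ {p cfg} (2p<n : 2 * p < totalCubes cfg) (short : All (λ s → length s ≤ p) cfg) where

  atLeastThreeStacks : 3 ≤ numStacks cfg
  atLeastThreeStacks = ≮⇒≥ λ ns<3 → <-irrefl refl (begin-strict
    totalCubes cfg     ≤⟨ totalCubes≤numStacks*p cfg short ⟩
    numStacks cfg * p  ≤⟨ *-monoˡ-≤ p (s≤s⁻¹ ns<3) ⟩
    2 * p              <⟨ 2p<n ⟩
    totalCubes cfg     ∎)
    where open ≤-Reasoning

  condA⊎atLeastTwoNonMono : (∀ c → colorCount c cfg ≤ p) → CondA cfg ⊎ 2 ≤ numNonMono cfg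
  condA⊎atLeastTwoNonMono rare with condA⊎monoStacksOfOneColour cfg
  ... | inj₁ condA = inj₁ condA
  ... | inj₂ (c , monoOfC) = inj₂ (≮⇒≥ λ nm<2 → <-irrefl refl (begin-strict
    totalCubes cfg                        ≤⟨ totalCubes≤numNonMono*p+colorCount cfg short monoOfC ⟩
    numNonMono cfg * p + colorCount c cfg ≤⟨ +-mono-≤ (*-monoˡ-≤ p (s≤s⁻¹ nm<2)) (rare c) ⟩
    1 * p + p                             ≡⟨ +-comm (1 * p) p ⟩
    2 * p                                 <⟨ 2p<n ⟩
    totalCubes cfg                        ∎))
    where open ≤-Reasoning

TopIsOrEmpty : Color → Stack → Set
TopIsOrEmpty c [] = ⊤
TopIsOrEmpty c (x ∷ _) = x ≡ c

topIsOrEmpty? : ∀ c → Decidable (TopIsOrEmpty c)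
topIsOrEmpty? c [] = yes tt
topIsOrEmpty? c (x ∷ _) = x ≟ c

TopsDiffer : Config → Set
TopsDiffer cfg = ∃[ s ] ∃[ t ] ∃[ c ] ∃[ d ] (s ∈ cfg × t ∈ cfg × TopIs c s × TopIs d t × c ≢ d)

topsDiffer⊎allTopsAre : ∀ {c ys} cfg → (c ∷ ys) ∈ cfg → TopsDiffer cfg ⊎ All (TopIsOrEmpty c) cfg
topsDiffer⊎allTopsAre {c} {ys} cfg t∈ with all? (topIsOrEmpty? c) cfg
... | yes tops = inj₂ tops
... | no ¬tops with find (¬All⇒Any¬ (topIsOrEmpty? c) cfg ¬tops)
...   | [] , _ , ¬top = ⊥-elim (¬top tt)
...   | x ∷ xs , s∈ , x≢c = inj₁ ((x ∷ xs) , (c ∷ ys) , x , c , s∈ , t∈ , refl , refl , x≢c)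

data LeadingRun (c : Color) : Stack → Set where
  uniform : ∀ {s} → All (_≡ c) s → LeadingRun c s
  broken  : ∀ r d rest → d ≢ c → LeadingRun c (replicate r c ++ d ∷ rest)

leadingRun : ∀ c s → LeadingRun c s
leadingRun c [] = uniform []
leadingRun c (x ∷ s) with x ≟ c
... | no x≢c = broken 0 x s x≢c
... | yes refl with leadingRun c s
...   | uniform all-c = uniform (refl ∷ all-c)
...   | broken r d rest d≢c = broken (suc r) d rest d≢c

broken⇒¬uniform : ∀ {c d : Color} r rest → d ≢ c → ¬ All (_≡ c) (replicate r c ++ d ∷ rest)
broken⇒¬uniform {c} r _ d≢c all-c = d≢c (All.head (++⁻ʳ (replicate r c) all-c))

ExposableWithin : ℕ → Color → Config → Set
ExposableWithin b c cfg = ∃[ pre ] ∃[ post ] ∃[ r ] ∃[ d ] ∃[ rest ]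
  (suc r ≤ b × d ≢ c × cfg ≡ pre ++ (replicate (suc r) c ++ d ∷ rest) ∷ post)

exposable-∷ : ∀ {b c cfg} s → ExposableWithin b c cfg → ExposableWithin b c (s ∷ cfg)
exposable-∷ s (pre , post , r , d , rest , r<b , d≢c , refl) = (s ∷ pre) , post , r , d , rest , r<b , d≢c , refl

exposable⊎manyOfColour : ∀ b c cfg → All (TopIsOrEmpty c) cfg →
  ExposableWithin b c cfg ⊎ numStacks cfg + numNonMono cfg * b ≤ colorCount c cfg
exposable⊎manyOfColour b c [] [] = inj₂ z≤n
exposable⊎manyOfColour b c ([] ∷ cfg) (_ ∷ tops) with exposable⊎manyOfColour b c cfg tops
... | inj₁ exposable = inj₁ (exposable-∷ [] exposable)
... | inj₂ many = inj₂ many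
exposable⊎manyOfColour b c ((c ∷ xs) ∷ cfg) (refl ∷ tops) with leadingRun c xs
... | uniform all-c = Sum.map (exposable-∷ _) addStack (exposable⊎manyOfColour b c cfg tops)
  where
  open ≤-Reasoning
  addStack : numStacks cfg + numNonMono cfg * b ≤ colorCount c cfg →
    numStacks ((c ∷ xs) ∷ cfg) + numNonMono ((c ∷ xs) ∷ cfg) * b ≤ colorCount c ((c ∷ xs) ∷ cfg)
  addStack many rewrite numNonMono-mono cfg all-c | colorCount-∷ c (c ∷ xs) cfg = begin
    suc (numStacks cfg + numNonMono cfg * b)  ≤⟨ s≤s (≤-trans many (m≤n+m _ (length xs))) ⟩
    length (c ∷ xs) + colorCount c cfg        ≡⟨ cong (_+ colorCount c cfg) (sym (count-all (refl ∷ all-c))) ⟩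
    count c (c ∷ xs) + colorCount c cfg       ∎
... | broken r d rest d≢c with suc r ≤? b
...   | yes r<b = inj₁ ([] , cfg , r , d , rest , r<b , d≢c , refl)
...   | no r≮b = Sum.map (exposable-∷ _) addStack (exposable⊎manyOfColour b c cfg tops)
  where
  open ≤-Reasoning
  s : Stack
  s = replicate (suc r) c ++ d ∷ rest
  addStack : numStacks cfg + numNonMono cfg * b ≤ colorCount c cfg →
    numStacks (s ∷ cfg) + numNonMono (s ∷ cfg) * b ≤ colorCount c (s ∷ cfg)
  addStack many = begin
    numStacks (s ∷ cfg) + numNonMono (s ∷ cfg) * b  ≡⟨ cong (λ k → numStacks (s ∷ cfg) + k * b)
                                                          (numNonMono-nonMono cfg (broken⇒¬uniform r rest d≢c)) ⟩
    suc (numStacks cfg + (b + numNonMono cfg * b))  ≡⟨ cong suc (x∙yz≈y∙xz (numStacks cfg) b _) ⟩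
    suc b + (numStacks cfg + numNonMono cfg * b)    ≤⟨ +-mono-≤ (≤-trans (≰⇒> r≮b) (count-replicate-++ (suc r) c _)) many ⟩
    count c s + colorCount c cfg                    ≡⟨ sym (colorCount-∷ c s cfg) ⟩
    colorCount c (s ∷ cfg)                          ∎

removeRun : ∀ pre post r c s → ReachIn r (pre ++ (replicate r c ++ s) ∷ post) (pre ++ s ∷ post)
removeRun pre post zero c s = done
removeRun pre post (suc r) c s = step (move pre post c (replicate r c ++ s)) (removeRun pre post r c s)

numStacks-↭ : ∀ {xs ys} → xs ↭ ys → numStacks xs ≡ numStacks ys
numStacks-↭ = length-filter-↭ nonEmpty?

numNonMono-↭ : ∀ {xs ys} → xs ↭ ys → numNonMono xs ≡ numNonMono ys
numNonMono-↭ = length-filter-↭ (λ s → ¬? (monochromatic? s))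

condA-↭ : ∀ {xs ys} → xs ↭ ys → CondA xs → CondA ys
condA-↭ p (s , t , c , d , s∈ , t∈ , rest) = s , t , c , d , ∈-resp-↭ p s∈ , ∈-resp-↭ p t∈ , rest

condB-↭ : ∀ {xs ys} → xs ↭ ys → CondB xs → CondB ys
condB-↭ p ((s , t , c , d , s∈ , t∈ , rest) , three , two) =
  (s , t , c , d , ∈-resp-↭ p s∈ , ∈-resp-↭ p t∈ , rest) ,
  subst (3 ≤_) (numStacks-↭ p) three , subst (2 ≤_) (numNonMono-↭ p) two

nonEmptyMember : ∀ cfg → 1 ≤ numStacks cfg → ∃[ x ] ∃[ xs ] ((x ∷ xs) ∈ cfg)
nonEmptyMember [] ()
nonEmptyMember ([] ∷ cfg) h with nonEmptyMember cfg h
... | x , xs , s∈ = x , xs , there s∈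
nonEmptyMember ((x ∷ xs) ∷ cfg) _ = x , xs , here refl

monoOf⊎numNonMono≡numStacks : ∀ {c} cfg → All (TopIsOrEmpty c) cfg →
  (∃[ t ] (t ∈ cfg × MonoOf c t)) ⊎ numNonMono cfg ≡ numStacks cfg
monoOf⊎numNonMono≡numStacks [] [] = inj₂ refl
monoOf⊎numNonMono≡numStacks ([] ∷ cfg) (_ ∷ tops) with monoOf⊎numNonMono≡numStacks cfg tops
... | inj₁ (t , t∈ , mono) = inj₁ (t , there t∈ , mono)
... | inj₂ eq = inj₂ eq
monoOf⊎numNonMono≡numStacks ((x ∷ xs) ∷ cfg) (refl ∷ tops) with all? (_≟ x) xs
... | yes mono = inj₁ ((x ∷ xs) , here refl , tt , refl ∷ mono)
... | no _ with monoOf⊎numNonMono≡numStacks cfg tops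
...   | inj₁ (t , t∈ , mono) = inj₁ (t , there t∈ , mono)
...   | inj₂ eq = inj₂ (cong suc eq)

topsDiffer-∷ : ∀ {c d} rest others → d ≢ c → All (TopIsOrEmpty c) others → 1 ≤ numStacks others →
  TopsDiffer ((d ∷ rest) ∷ others)
topsDiffer-∷ {c} {d} rest others d≢c tops oneStack with nonEmptyMember others oneStack
... | x , xs , t∈ with refl ← All.lookup tops t∈ =
  (d ∷ rest) , (x ∷ xs) , d , x , here refl , there t∈ , refl , refl , d≢c

exposedTop⇒condA⊎condB : ∀ {c d} rest others → d ≢ c → All (TopIsOrEmpty c) others →
  2 ≤ numStacks others → 1 ≤ numNonMono others → CondA ((d ∷ rest) ∷ others) ⊎ CondB ((d ∷ rest) ∷ others)
exposedTop⇒condA⊎condB {c} {d} rest others d≢c tops twoStacks oneNonMono with all? (_≟ d) rest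
... | no _ = inj₂ (topsDiffer-∷ rest others d≢c tops (<⇒≤ twoStacks) , s≤s twoStacks , s≤s oneNonMono)
... | yes mono with monoOf⊎numNonMono≡numStacks others tops
...   | inj₁ (t , t∈ , monoT) = inj₁ ((d ∷ rest) , t , d , c , here refl , there t∈ , (tt , refl ∷ mono) , monoT , d≢c)
...   | inj₂ nm≡ns = inj₂ (topsDiffer-∷ rest others d≢c tops (<⇒≤ twoStacks) , s≤s twoStacks ,
                            subst (2 ≤_) (sym nm≡ns) twoStacks)

exposing⇒condA⊎condB : ∀ {c d x} xs pre post rest → d ≢ c →
  let cfg = pre ++ (x ∷ xs) ∷ post in
  All (TopIsOrEmpty c) cfg → 3 ≤ numStacks cfg → 2 ≤ numNonMono cfg →
  CondA (pre ++ (d ∷ rest) ∷ post) ⊎ CondB (pre ++ (d ∷ rest) ∷ post)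
exposing⇒condA⊎condB {x = x} xs pre post rest d≢c tops threeStacks twoNonMono =
  Sum.map (condA-↭ toFront) (condB-↭ toFront)
    (exposedTop⇒condA⊎condB rest (pre ++ post) d≢c (All.tail (All-resp-↭ fromFront tops))
      (s≤s⁻¹ (subst (3 ≤_) (numStacks-↭ fromFront) threeStacks))
      (s≤s⁻¹ (≤-trans (subst (2 ≤_) (numNonMono-↭ fromFront) twoNonMono) (numNonMono-∷-≤ (x ∷ xs) (pre ++ post)))))
  where
  fromFront : pre ++ (x ∷ xs) ∷ post ↭ (x ∷ xs) ∷ pre ++ post
  fromFront = shift _ pre post
  toFront : (_ ∷ rest) ∷ pre ++ post ↭ pre ++ (_ ∷ rest) ∷ post
  toFront = ↭-sym (shift _ pre post)

fewMovesSuffice : ∀ p b cfg → p ≤ 2 + 2 * b → 2 * p < totalCubes cfg →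
  All (λ s → length s ≤ p) cfg → (∀ c → colorCount c cfg ≤ p) →
  ∃[ k ] ∃[ cfg′ ] (k ≤ b × ReachIn k cfg cfg′ × (CondA cfg′ ⊎ CondB cfg′))
fewMovesSuffice p b cfg budget 2p<n short rare
  with atLeastThreeStacks 2p<n short | condA⊎atLeastTwoNonMono 2p<n short rare
... | _ | inj₁ condA = 0 , cfg , z≤n , done , inj₁ condA
... | threeStacks | inj₂ twoNonMono with nonEmptyMember cfg (≤-trans (s≤s z≤n) threeStacks)
...   | c , _ , t∈ with topsDiffer⊎allTopsAre cfg t∈
...     | inj₁ topsDiffer = 0 , cfg , z≤n , done , inj₂ (topsDiffer , threeStacks , twoNonMono)
...     | inj₂ tops with exposable⊎manyOfColour b c cfg tops
...       | inj₁ (pre , post , r , d , rest , r<b , d≢c , refl) =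
  suc r , pre ++ (d ∷ rest) ∷ post , r<b , removeRun pre post (suc r) c (d ∷ rest) ,
  exposing⇒condA⊎condB _ pre post rest d≢c tops threeStacks twoNonMono
...       | inj₂ many = ⊥-elim (<-irrefl refl (begin-strict
  p                                          <⟨ s≤s budget ⟩
  3 + 2 * b                                  ≤⟨ +-mono-≤ threeStacks (*-monoˡ-≤ b twoNonMono) ⟩
  numStacks cfg + numNonMono cfg * b         ≤⟨ many ⟩
  colorCount c cfg                           ≤⟨ rare c ⟩
  p                                          ∎))
  where open ≤-Reasoning

2*⌊n/2⌋≤n : ∀ n → 2 * ⌊ n /2⌋ ≤ n
2*⌊n/2⌋≤n n = begin
  2 * ⌊ n /2⌋           ≡⟨ cong (⌊ n /2⌋ +_) (+-identityʳ ⌊ n /2⌋) ⟩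
  ⌊ n /2⌋ + ⌊ n /2⌋     ≤⟨ +-monoʳ-≤ ⌊ n /2⌋ (⌊n/2⌋≤⌈n/2⌉ n) ⟩
  ⌊ n /2⌋ + ⌈ n /2⌉     ≡⟨ ⌊n/2⌋+⌈n/2⌉≡n n ⟩
  n                     ∎
  where open ≤-Reasoning

n≤1+2*⌊n/2⌋ : ∀ n → n ≤ 1 + 2 * ⌊ n /2⌋
n≤1+2*⌊n/2⌋ zero = z≤n
n≤1+2*⌊n/2⌋ (suc zero) = ≤-refl
n≤1+2*⌊n/2⌋ (suc (suc n)) = s≤s (s≤s (subst (n ≤_) (sym (+-suc ⌊ n /2⌋ _)) (n≤1+2*⌊n/2⌋ n)))

n≤2+2*[⌈n/2⌉∸1] : ∀ n → n ≤ 2 + 2 * (⌈ n /2⌉ ∸ 1)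
n≤2+2*[⌈n/2⌉∸1] zero = z≤n
n≤2+2*[⌈n/2⌉∸1] (suc n) = s≤s (n≤1+2*⌊n/2⌋ n)

mainTheorem7 : (n : ℕ) → 0 < n → (cfg : Config) →
    totalCubes cfg ≡ n →
    (∀ s → s ∈ cfg → length s < ⌈ n /2⌉) →
    (∀ c → colorCount c cfg < ⌈ n /2⌉) →
    ∃[ k ] ∃[ cfg' ] (k ≤ ⌊ ⌈ n /2⌉ /2⌋ ∸ 1 × ReachIn k cfg cfg' × (CondA cfg' ⊎ CondB cfg'))
mainTheorem7 zero () _ _ _ _
mainTheorem7 (suc n) _ cfg total shortStacks rareColours =
  fewMovesSuffice p (⌈ p /2⌉ ∸ 1) cfg (n≤2+2*[⌈n/2⌉∸1] p)
    (subst (2 * p <_) (sym total) (s≤s (2*⌊n/2⌋≤n n)))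
    (All.tabulate λ s∈ → s≤s⁻¹ (shortStacks _ s∈))
    (λ c → s≤s⁻¹ (rareColours c))
  where
  p : ℕ
  p = ⌊ n /2⌋
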